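{- For every pair of words $\bm{x},\bm{y}$ in the alphabet $\{0,\times\}$, the power series $R_{\bm{x},\bm{y}}(q,t,a)$ can be expressed as a rational function whose denominator is a power of $(1-q)$.
   Context: The series $R_{\bm{x},\bm{y}}(q,t,a)$ (Hogancamp–Mellit), indexed by pairs of words in $\{0,\times\}$, are determined by the relations $R_{0\bm{x},0\bm{y}}=t^{ -|\bm{x}|}R_{\bm{x}\times,\bm{y}\times}+q\,t^{ -|\bm{x}|}R_{\bm{x}0,\bm{y}0}$, $R_{\times\bm{x},0\bm{y}}=R_{\bm{x}\times,\bm{y}}$, $R_{0\bm{x},\times\bm{y}}=R_{\bm{x},\bm{y}\times}$, $R_{\times\bm{x},\times\bm{y}}=(t^{|\bm{x}|}+a)R_{\bm{x},\bm{y}}$, $R_{\emptyset,\emptyset}=1$, where $|\bm{x}|$ denotes the number of letters $\times$ in $\bm{x}$. -}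

module Defs where

open import Data.Nat as ℕ using (ℕ; zero; suc)
open import Data.Integer as ℤ using (ℤ)
open import Data.List using (List; []; _∷_; _++_; map; concatMap; _∷ʳ_)
open import Data.Product using (_×_; _,_)
open import Data.Bool using (Bool; true; false; _∧_; if_then_else_)
open import Relation.Nullary.Decidable using (⌊_⌋)
open import Relation.Binary.PropositionalEquality using (_≡_)

data Letter : Set where
  𝟘 : Letter
  ✕ : Letter

Word : Set
Word = List Letter

∣_∣ₓ : Word → ℕ
∣ [] ∣ₓ = 0
∣ 𝟘 ∷ x ∣ₓ = ∣ x ∣ₓ
∣ ✕ ∷ x ∣ₓ = suc ∣ x ∣ₓ

-- The coefficient ring ℤ[t^{±1}, a]  (concrete model).
-- An element is a finite formal sum of monomials  c · t^i · a^j
-- (c ∈ ℤ, i ∈ ℤ, j ∈ ℕ), given as a list of triples (c , i , j).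

Mono : Set
Mono = ℤ × ℤ × ℕ

L : Set
L = List Mono

coeff : L → ℤ → ℕ → ℤ
coeff [] i j = ℤ.0ℤ
coeff ((c , i′ , j′) ∷ p) i j =
  (if ⌊ i′ ℤ.≟ i ⌋ ∧ ⌊ j′ ℕ.≟ j ⌋ then c else ℤ.0ℤ) ℤ.+ coeff p i j

_≈L_ : L → L → Set
p ≈L q = ∀ i j → coeff p i j ≡ coeff q i j

infix 4 _≈L_
infixl 6 _+L_ _-L_
infixl 7 _*L_

0L : L
0L = []

1L : L
1L = (ℤ.1ℤ , ℤ.0ℤ , 0) ∷ []

_+L_ : L → L → L
p +L q = p ++ q

-L_ : L → L
-L p = map (λ { (c , i , j) → (ℤ.- c , i , j) }) p

_-L_ : L → L → L
p -L q = p +L (-L q)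

_*L_ : L → L → L
p *L q = concatMap (λ { (c , i , j) →
           map (λ { (c′ , i′ , j′) → (c ℤ.* c′ , i ℤ.+ i′ , j ℕ.+ j′) }) q }) p

tPow : ℤ → L
tPow i = (ℤ.1ℤ , i , 0) ∷ []

aL : L
aL = (ℤ.1ℤ , ℤ.0ℤ , 1) ∷ []

-- Formal power series in q over ℤ[t^{±1},a]: sequences of coefficients.
-- A series f stands for Σ_n f n · q^n.

Series : Set
Series = ℕ → L

mul1-q : Series → Series
mul1-q f zero = f zero
mul1-q f (suc n) = f (suc n) -L f n

mul1-q^ : ℕ → Series → Series
mul1-q^ zero f = f
mul1-q^ (suc k) f = mul1-q (mul1-q^ k f)

polySeries : List L → Series
polySeries [] n = 0L
polySeries (p ∷ ps) zero = p
polySeries (p ∷ ps) (suc n) = polySeries ps n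

-- The Hogancamp–Mellit relations, read coefficientwise in q.
-- RCoeff x y n c  means: the relations force the coefficient of q^n in
-- R_{x,y} to be c.  Writing R_{x,y} = Σ_n r_n q^n, the relations are
--   r_n(0x,0y) = t^{-|x|} r_n(x×,y×) + t^{-|x|} r_{n-1}(x0,y0)   (r_{-1} = 0)
--   r_n(×x,0y) = r_n(x×,y)
--   r_n(0x,×y) = r_n(x,y×)
--   r_n(×x,×y) = (t^{|x|} + a) r_n(x,y)
--   r_0(∅,∅) = 1,  r_{n+1}(∅,∅) = 0.

data RCoeff : Word → Word → ℕ → L → Set where
  empty₀ : RCoeff [] [] 0 1L
  emptyₛ : ∀ {n} → RCoeff [] [] (suc n) 0L
  00-zero : ∀ {x y c} →
    RCoeff (x ∷ʳ ✕) (y ∷ʳ ✕) 0 c →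
    RCoeff (𝟘 ∷ x) (𝟘 ∷ y) 0 (tPow (ℤ.- ℤ.+ ∣ x ∣ₓ) *L c)
  00-suc : ∀ {x y n c d} →
    RCoeff (x ∷ʳ ✕) (y ∷ʳ ✕) (suc n) c →
    RCoeff (x ∷ʳ 𝟘) (y ∷ʳ 𝟘) n d →
    RCoeff (𝟘 ∷ x) (𝟘 ∷ y) (suc n)
      (tPow (ℤ.- ℤ.+ ∣ x ∣ₓ) *L c +L tPow (ℤ.- ℤ.+ ∣ x ∣ₓ) *L d)
  ✕0 : ∀ {x y n c} →
    RCoeff (x ∷ʳ ✕) y n c →
    RCoeff (✕ ∷ x) (𝟘 ∷ y) n c
  0✕ : ∀ {x y n c} →
    RCoeff x (y ∷ʳ ✕) n c →
    RCoeff (𝟘 ∷ x) (✕ ∷ y) n c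
  ✕✕ : ∀ {x y n c} →
    RCoeff x y n c →
    RCoeff (✕ ∷ x) (✕ ∷ y) n ((tPow (ℤ.+ ∣ x ∣ₓ) +L aL) *L c)

-- R is the power series R_{x,y}: every coefficient is the one forced by
-- the relations.
IsR : Word → Word → Series → Set
IsR x y R = ∀ n → RCoeff x y n (R n)

-- Give a 0 weight 2 and a × weight 1.  Every series on the right-hand side of
-- a relation has smaller total weight than the left-hand side, except R_{x0,y0}
-- in the first relation, obtained by the weight-preserving rotation
-- (0x,0y) ↦ (x0,y0).  If one of the words contains a ×, finitely many rotations
-- bring a × to the front or empty a word, so unfolding reaches series of
-- smaller weight, rational by induction; rational series (those f with
-- (1 - q)^k f a polynomial) are closed under sums, scalar multiples and
-- multiplication by q.  If the words are 0^{k+1} and 0^{l+1}, the rotation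
-- fixes them and the first relation reads R = R_{0^k×,0^l×} + q R, so
-- (1 - q) R = R_{0^k×,0^l×}.

module Submission where

open import Algebra.Properties.CommutativeSemigroup using (interchange; x∙yz≈y∙xz)
open import Data.Bool using (true; false; _∧_; if_then_else_)
open import Data.Bool.Properties using (∧-zeroʳ)
open import Data.Integer as ℤ using (ℤ; +_; 0ℤ; _+_; _*_; -_; _-_)
import Data.Integer.Properties as ℤP
open import Data.Integer.Tactic.RingSolver using (solve-∀)
open import Data.List using (List; []; _∷_; _++_; _∷ʳ_; map; replicate)
open import Data.List.Properties using (map-++; ++-identityʳ; ++-assoc)
open import Data.Nat as ℕ using (ℕ; zero; suc; _<_; _≤_; _∸_)
open import Data.Nat.Induction using (<-rec)
import Data.Nat.Properties as ℕP
open import Data.Product using (Σ; ∃; ∃-syntax; _×_; _,_; proj₁; proj₂)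
open import Function.Bundles using (_⇔_; mk⇔)
open import Level using (0ℓ)
open import Relation.Binary.Bundles using (Setoid)
open import Relation.Binary.PropositionalEquality
import Relation.Binary.Reasoning.Setoid as SetoidReasoning
open import Relation.Nullary using (¬_; Dec; yes; no)
open import Relation.Nullary.Decidable using (⌊_⌋; isYes≗does; does-⇔; dec-false)

open import Defs

⌊⌋-⇔ : ∀ {a b} {A : Set a} {B : Set b} → A ⇔ B → (a? : Dec A) (b? : Dec B) → ⌊ a? ⌋ ≡ ⌊ b? ⌋
⌊⌋-⇔ A⇔B a? b? = trans (isYes≗does a?) (trans (does-⇔ A⇔B a? b?) (sym (isYes≗does b?)))

⌊⌋-false : ∀ {a} {A : Set a} (a? : Dec A) → ¬ A → ⌊ a? ⌋ ≡ false
⌊⌋-false a? ¬a = trans (isYes≗does a?) (dec-false a? ¬a)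

if-neg : ∀ b c → (if b then - c else 0ℤ) ≡ - (if b then c else 0ℤ)
if-neg true  c = refl
if-neg false c = refl

if-*ˡ : ∀ b d c → (if b then d * c else 0ℤ) ≡ d * (if b then c else 0ℤ)
if-*ˡ true  d c = refl
if-*ˡ false d c = sym (ℤP.*-zeroʳ d)

coeffMono : Mono → ℤ → ℕ → ℤ
coeffMono (c , i′ , j′) i j = if ⌊ i′ ℤ.≟ i ⌋ ∧ ⌊ j′ ℕ.≟ j ⌋ then c else 0ℤ

coeff-++ : ∀ p q i j → coeff (p +L q) i j ≡ coeff p i j + coeff q i j
coeff-++ []      q i j = sym (ℤP.+-identityˡ _)
coeff-++ (m ∷ p) q i j = trans (cong (_+_ (coeffMono m i j)) (coeff-++ p q i j))
                               (sym (ℤP.+-assoc (coeffMono m i j) (coeff p i j) (coeff q i j)))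

coeff-neg : ∀ p i j → coeff (-L p) i j ≡ - coeff p i j
coeff-neg []                  i j = refl
coeff-neg ((c , i′ , j′) ∷ p) i j =
  trans (cong₂ _+_ (if-neg (⌊ i′ ℤ.≟ i ⌋ ∧ ⌊ j′ ℕ.≟ j ⌋) c) (coeff-neg p i j))
        (sym (ℤP.neg-distrib-+ (coeffMono (c , i′ , j′) i j) (coeff p i j)))

mulMono : Mono → Mono → Mono
mulMono (c , i , j) (c′ , i′ , j′) = (c * c′ , i + i′ , j ℕ.+ j′)

coeff-mulMono-≤ : ∀ d i₀ j₀ p i j → j₀ ≤ j →
  coeff (map (mulMono (d , i₀ , j₀)) p) i j ≡ d * coeff p (i - i₀) (j ∸ j₀)
coeff-mulMono-≤ d i₀ j₀ []                  i j j₀≤j = sym (ℤP.*-zeroʳ d)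
coeff-mulMono-≤ d i₀ j₀ ((c , i′ , j′) ∷ p) i j j₀≤j =
  trans (cong₂ _+_ head (coeff-mulMono-≤ d i₀ j₀ p i j j₀≤j))
        (sym (ℤP.*-distribˡ-+ d (coeffMono (c , i′ , j′) (i - i₀) (j ∸ j₀)) (coeff p (i - i₀) (j ∸ j₀))))
  where
  i-shift : i₀ + i′ ≡ i ⇔ i′ ≡ i - i₀
  i-shift = mk⇔ (λ { refl → n≡[m+n]-m i₀ i′ }) (λ { refl → m+[n-m]≡n i₀ i })
    where
    n≡[m+n]-m : ∀ a b → b ≡ (a + b) - a
    n≡[m+n]-m = solve-∀
    m+[n-m]≡n : ∀ a b → a + (b - a) ≡ b
    m+[n-m]≡n = solve-∀
  j-shift : j₀ ℕ.+ j′ ≡ j ⇔ j′ ≡ j ∸ j₀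
  j-shift = mk⇔ (λ { refl → sym (ℕP.m+n∸m≡n j₀ j′) }) (λ { refl → ℕP.m+[n∸m]≡n j₀≤j })
  head : coeffMono (d * c , i₀ + i′ , j₀ ℕ.+ j′) i j ≡ d * coeffMono (c , i′ , j′) (i - i₀) (j ∸ j₀)
  head rewrite ⌊⌋-⇔ i-shift (i₀ + i′ ℤ.≟ i) (i′ ℤ.≟ i - i₀)
             | ⌊⌋-⇔ j-shift (j₀ ℕ.+ j′ ℕ.≟ j) (j′ ℕ.≟ j ∸ j₀)
             = if-*ˡ (⌊ i′ ℤ.≟ i - i₀ ⌋ ∧ ⌊ j′ ℕ.≟ j ∸ j₀ ⌋) d c

coeff-mulMono-≰ : ∀ d i₀ j₀ p i j → ¬ j₀ ≤ j →
  coeff (map (mulMono (d , i₀ , j₀)) p) i j ≡ 0ℤ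
coeff-mulMono-≰ d i₀ j₀ []                  i j j₀≰j = refl
coeff-mulMono-≰ d i₀ j₀ ((c , i′ , j′) ∷ p) i j j₀≰j
  rewrite ⌊⌋-false (j₀ ℕ.+ j′ ℕ.≟ j) (λ { refl → j₀≰j (ℕP.m≤m+n j₀ j′) })
        | ∧-zeroʳ ⌊ i₀ + i′ ℤ.≟ i ⌋
        = trans (ℤP.+-identityˡ _) (coeff-mulMono-≰ d i₀ j₀ p i j j₀≰j)

-- A record, unlike _≈L_, lets Agda infer both sides from a proof.
infix 4 _≈_
record _≈_ (p q : L) : Set where
  constructor coeffwise
  field coeff-≡ : p ≈L q
open _≈_ public

≈-refl : ∀ {p} → p ≈ p
≈-refl = coeffwise λ i j → refl

≈-reflexive : ∀ {p q} → p ≡ q → p ≈ q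
≈-reflexive refl = ≈-refl

≈-sym : ∀ {p q} → p ≈ q → q ≈ p
≈-sym (coeffwise e) = coeffwise λ i j → sym (e i j)

≈-trans : ∀ {p q r} → p ≈ q → q ≈ r → p ≈ r
≈-trans (coeffwise e) (coeffwise e′) = coeffwise λ i j → trans (e i j) (e′ i j)

≈-setoid : Setoid 0ℓ 0ℓ
≈-setoid = record
  { Carrier = L ; _≈_ = _≈_
  ; isEquivalence = record { refl = ≈-refl ; sym = ≈-sym ; trans = ≈-trans } }

+L-cong : ∀ {p p′ q q′} → p ≈ p′ → q ≈ q′ → p +L q ≈ p′ +L q′
+L-cong {p} {p′} {q} {q′} (coeffwise e) (coeffwise e′) = coeffwise λ i j →
  trans (coeff-++ p q i j) (trans (cong₂ _+_ (e i j) (e′ i j)) (sym (coeff-++ p′ q′ i j)))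

-L-cong : ∀ {p q} → p ≈ q → -L p ≈ -L q
-L-cong {p} {q} (coeffwise e) = coeffwise λ i j →
  trans (coeff-neg p i j) (trans (cong -_ (e i j)) (sym (coeff-neg q i j)))

+L-interchange : ∀ p q r s → (p +L q) +L (r +L s) ≈ (p +L r) +L (q +L s)
+L-interchange p q r s = coeffwise λ i j → begin
  coeff ((p ++ q) ++ (r ++ s)) i j
    ≡⟨ coeff-++ (p ++ q) (r ++ s) i j ⟩
  coeff (p ++ q) i j + coeff (r ++ s) i j
    ≡⟨ cong₂ _+_ (coeff-++ p q i j) (coeff-++ r s i j) ⟩
  (coeff p i j + coeff q i j) + (coeff r i j + coeff s i j)
    ≡⟨ interchange ℤP.+-commutativeSemigroup (coeff p i j) (coeff q i j) (coeff r i j) (coeff s i j) ⟩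
  (coeff p i j + coeff r i j) + (coeff q i j + coeff s i j)
    ≡⟨ sym (cong₂ _+_ (coeff-++ p r i j) (coeff-++ q s i j)) ⟩
  coeff (p ++ r) i j + coeff (q ++ s) i j
    ≡⟨ sym (coeff-++ (p ++ r) (q ++ s) i j) ⟩
  coeff ((p ++ r) ++ (q ++ s)) i j ∎
  where open ≡-Reasoning

+L-inverseʳ : ∀ p → p +L -L p ≈ 0L
+L-inverseʳ p = coeffwise λ i j →
  trans (coeff-++ p (-L p) i j) (trans (cong (_+_ (coeff p i j)) (coeff-neg p i j)) (ℤP.+-inverseʳ (coeff p i j)))

mulMono-cong : ∀ m {p q} → p ≈ q → map (mulMono m) p ≈ map (mulMono m) q
mulMono-cong (d , i₀ , j₀) {p} {q} (coeffwise e) = coeffwise λ i j → shifted i j (j₀ ℕ.≤? j)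
  where
  shifted : ∀ i j → Dec (j₀ ≤ j) →
    coeff (map (mulMono (d , i₀ , j₀)) p) i j ≡ coeff (map (mulMono (d , i₀ , j₀)) q) i j
  shifted i j (yes j₀≤j) = trans (coeff-mulMono-≤ d i₀ j₀ p i j j₀≤j)
    (trans (cong (d *_) (e (i - i₀) (j ∸ j₀))) (sym (coeff-mulMono-≤ d i₀ j₀ q i j j₀≤j)))
  shifted i j (no j₀≰j) = trans (coeff-mulMono-≰ d i₀ j₀ p i j j₀≰j) (sym (coeff-mulMono-≰ d i₀ j₀ q i j j₀≰j))

mulMono-neg : ∀ m p → map (mulMono m) (-L p) ≡ -L map (mulMono m) p
mulMono-neg m                  []                  = refl
mulMono-neg m@(d , i₀ , j₀)    ((c , i′ , j′) ∷ p) =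
  cong₂ _∷_ (cong (_, i₀ + i′ , j₀ ℕ.+ j′) (sym (ℤP.neg-distribʳ-* d c))) (mulMono-neg m p)

*L-congˡ : ∀ c {p q} → p ≈ q → c *L p ≈ c *L q
*L-congˡ []      p≈q = ≈-refl
*L-congˡ (m ∷ c) p≈q = +L-cong (mulMono-cong m p≈q) (*L-congˡ c p≈q)

*L-negʳ : ∀ c p → c *L (-L p) ≡ -L (c *L p)
*L-negʳ []      p = refl
*L-negʳ (m ∷ c) p =
  trans (cong₂ _++_ (mulMono-neg m p) (*L-negʳ c p)) (sym (map-++ _ (map (mulMono m) p) (c *L p)))

*L-distribˡ-+L : ∀ c p q → c *L (p +L q) ≈ c *L p +L c *L q
*L-distribˡ-+L []      p q = ≈-refl
*L-distribˡ-+L (m ∷ c) p q = begin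
  map (mulMono m) (p ++ q) ++ c *L (p ++ q)
    ≈⟨ +L-cong (≈-reflexive (map-++ (mulMono m) p q)) (*L-distribˡ-+L c p q) ⟩
  (map (mulMono m) p ++ map (mulMono m) q) ++ (c *L p ++ c *L q)
    ≈⟨ +L-interchange (map (mulMono m) p) (map (mulMono m) q) (c *L p) (c *L q) ⟩
  (map (mulMono m) p ++ c *L p) ++ (map (mulMono m) q ++ c *L q) ∎
  where open SetoidReasoning ≈-setoid

*L-zeroʳ : ∀ c → c *L 0L ≡ 0L
*L-zeroʳ []      = refl
*L-zeroʳ (m ∷ c) = *L-zeroʳ c

*L-identityˡ : ∀ p → 1L *L p ≡ p
*L-identityˡ p = trans (++-identityʳ _) (unit p)
  where
  unit : ∀ p → map (mulMono (ℤ.1ℤ , 0ℤ , 0)) p ≡ p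
  unit []                  = refl
  unit ((c , i , j) ∷ p) =
    cong₂ _∷_ (cong₂ (λ c′ i′ → c′ , i′ , j) (ℤP.*-identityˡ c) (ℤP.+-identityˡ i)) (unit p)

infix 4 _≋_
_≋_ : Series → Series → Set
f ≋ g = ∀ n → f n ≈ g n

≋-refl : ∀ {f} → f ≋ f
≋-refl n = ≈-refl

≋-trans : ∀ {f g h} → f ≋ g → g ≋ h → f ≋ h
≋-trans f≋g g≋h n = ≈-trans (f≋g n) (g≋h n)

infixl 6 _⊕_
infixr 7 _⊙_ q·_ ⊖_

_⊕_ : Series → Series → Series
(f ⊕ g) n = f n +L g n

_⊙_ : L → Series → Series
(c ⊙ f) n = c *L f n

⊖_ : Series → Series
(⊖ f) n = -L f n

q·_ : Series → Series
(q· f) zero    = 0L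
(q· f) (suc n) = f n

⊕-cong : ∀ {f f′ g g′} → f ≋ f′ → g ≋ g′ → f ⊕ g ≋ f′ ⊕ g′
⊕-cong f≋f′ g≋g′ n = +L-cong (f≋f′ n) (g≋g′ n)

⊙-cong : ∀ c {f g} → f ≋ g → c ⊙ f ≋ c ⊙ g
⊙-cong c f≋g n = *L-congˡ c (f≋g n)

q·-cong : ∀ {f g} → f ≋ g → q· f ≋ q· g
q·-cong f≋g zero    = ≈-refl
q·-cong f≋g (suc n) = f≋g n

mul1-q-cong : ∀ {f g} → f ≋ g → mul1-q f ≋ mul1-q g
mul1-q-cong f≋g zero    = f≋g zero
mul1-q-cong f≋g (suc n) = +L-cong (f≋g (suc n)) (-L-cong (f≋g n))

mul1-q-⊕ : ∀ f g → mul1-q (f ⊕ g) ≋ mul1-q f ⊕ mul1-q g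
mul1-q-⊕ f g zero    = ≈-refl
mul1-q-⊕ f g (suc n) =
  ≈-trans (+L-cong ≈-refl (≈-reflexive (map-++ _ (f n) (g n))))
          (+L-interchange (f (suc n)) (g (suc n)) (-L f n) (-L g n))

mul1-q-⊙ : ∀ c f → mul1-q (c ⊙ f) ≋ c ⊙ mul1-q f
mul1-q-⊙ c f zero    = ≈-refl
mul1-q-⊙ c f (suc n) = ≈-sym (begin
  c *L (f (suc n) +L -L f n)     ≈⟨ *L-distribˡ-+L c (f (suc n)) (-L f n) ⟩
  c *L f (suc n) +L c *L -L f n  ≡⟨ cong (c *L f (suc n) +L_) (*L-negʳ c (f n)) ⟩
  c *L f (suc n) +L -L (c *L f n) ∎)
  where open SetoidReasoning ≈-setoid

mul1-q-q· : ∀ f → mul1-q (q· f) ≋ q· mul1-q f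
mul1-q-q· f zero          = ≈-refl
mul1-q-q· f (suc zero)    = ≈-reflexive (++-identityʳ (f zero))
mul1-q-q· f (suc (suc n)) = ≈-refl

mul1-q-⊖-q· : ∀ f → mul1-q f ≋ f ⊕ ⊖ q· f
mul1-q-⊖-q· f zero    = ≈-reflexive (sym (++-identityʳ (f zero)))
mul1-q-⊖-q· f (suc n) = ≈-refl

mul1-q^-cong : ∀ k {f g} → f ≋ g → mul1-q^ k f ≋ mul1-q^ k g
mul1-q^-cong zero    f≋g = f≋g
mul1-q^-cong (suc k) f≋g = mul1-q-cong (mul1-q^-cong k f≋g)

mul1-q^-⊕ : ∀ k f g → mul1-q^ k (f ⊕ g) ≋ mul1-q^ k f ⊕ mul1-q^ k g
mul1-q^-⊕ zero    f g = ≋-refl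
mul1-q^-⊕ (suc k) f g = ≋-trans (mul1-q-cong (mul1-q^-⊕ k f g)) (mul1-q-⊕ (mul1-q^ k f) (mul1-q^ k g))

mul1-q^-⊙ : ∀ k c f → mul1-q^ k (c ⊙ f) ≋ c ⊙ mul1-q^ k f
mul1-q^-⊙ zero    c f = ≋-refl
mul1-q^-⊙ (suc k) c f = ≋-trans (mul1-q-cong (mul1-q^-⊙ k c f)) (mul1-q-⊙ c (mul1-q^ k f))

mul1-q^-q· : ∀ k f → mul1-q^ k (q· f) ≋ q· mul1-q^ k f
mul1-q^-q· zero    f = ≋-refl
mul1-q^-q· (suc k) f = ≋-trans (mul1-q-cong (mul1-q^-q· k f)) (mul1-q-q· (mul1-q^ k f))

fixpoint⇒mul1-q : ∀ {f g} → f ≋ g ⊕ q· f → mul1-q f ≋ g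
fixpoint⇒mul1-q {f} {g} f≋g+qf zero    = ≈-trans (f≋g+qf zero) (≈-reflexive (++-identityʳ (g zero)))
fixpoint⇒mul1-q {f} {g} f≋g+qf (suc n) = begin
  f (suc n) +L -L f n             ≈⟨ +L-cong (f≋g+qf (suc n)) ≈-refl ⟩
  (g (suc n) +L f n) +L -L f n    ≡⟨ ++-assoc (g (suc n)) (f n) (-L f n) ⟩
  g (suc n) +L (f n +L -L f n)    ≈⟨ +L-cong ≈-refl (+L-inverseʳ (f n)) ⟩
  g (suc n) +L 0L                 ≡⟨ ++-identityʳ (g (suc n)) ⟩
  g (suc n)                       ∎
  where open SetoidReasoning ≈-setoid

IsPolynomial : Series → Set
IsPolynomial f = Σ (List L) λ P → f ≋ polySeries P

IsRational : Series → Set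
IsRational f = Σ ℕ λ k → IsPolynomial (mul1-q^ k f)

_+P_ : List L → List L → List L
[]      +P Q       = Q
(p ∷ P) +P []      = p ∷ P
(p ∷ P) +P (q ∷ Q) = (p +L q) ∷ (P +P Q)

polySeries-+P : ∀ P Q → polySeries P ⊕ polySeries Q ≋ polySeries (P +P Q)
polySeries-+P []      Q       n       = ≈-refl
polySeries-+P (p ∷ P) []      n       = ≈-reflexive (++-identityʳ _)
polySeries-+P (p ∷ P) (q ∷ Q) zero    = ≈-refl
polySeries-+P (p ∷ P) (q ∷ Q) (suc n) = polySeries-+P P Q n

polySeries-⊙ : ∀ c P → c ⊙ polySeries P ≋ polySeries (map (c *L_) P)
polySeries-⊙ c []      n       = ≈-reflexive (*L-zeroʳ c)
polySeries-⊙ c (p ∷ P) zero    = ≈-refl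
polySeries-⊙ c (p ∷ P) (suc n) = polySeries-⊙ c P n

polySeries-⊖ : ∀ P → ⊖ polySeries P ≋ polySeries (map -L_ P)
polySeries-⊖ []      n       = ≈-refl
polySeries-⊖ (p ∷ P) zero    = ≈-refl
polySeries-⊖ (p ∷ P) (suc n) = polySeries-⊖ P n

polySeries-q· : ∀ P → q· polySeries P ≋ polySeries (0L ∷ P)
polySeries-q· P zero    = ≈-refl
polySeries-q· P (suc n) = ≈-refl

isPolynomial-resp : ∀ {f g} → f ≋ g → IsPolynomial g → IsPolynomial f
isPolynomial-resp f≋g (P , g≋P) = P , ≋-trans f≋g g≋P

isPolynomial-⊕ : ∀ {f g} → IsPolynomial f → IsPolynomial g → IsPolynomial (f ⊕ g)
isPolynomial-⊕ (P , f≋P) (Q , g≋Q) = P +P Q , ≋-trans (⊕-cong f≋P g≋Q) (polySeries-+P P Q)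

isPolynomial-⊙ : ∀ c {f} → IsPolynomial f → IsPolynomial (c ⊙ f)
isPolynomial-⊙ c (P , f≋P) = map (c *L_) P , ≋-trans (⊙-cong c f≋P) (polySeries-⊙ c P)

isPolynomial-⊖ : ∀ {f} → IsPolynomial f → IsPolynomial (⊖ f)
isPolynomial-⊖ (P , f≋P) = map -L_ P , ≋-trans (λ n → -L-cong (f≋P n)) (polySeries-⊖ P)

isPolynomial-q· : ∀ {f} → IsPolynomial f → IsPolynomial (q· f)
isPolynomial-q· (P , f≋P) = 0L ∷ P , ≋-trans (q·-cong f≋P) (polySeries-q· P)

isPolynomial-mul1-q : ∀ {f} → IsPolynomial f → IsPolynomial (mul1-q f)
isPolynomial-mul1-q poly =
  isPolynomial-resp (mul1-q-⊖-q· _) (isPolynomial-⊕ poly (isPolynomial-⊖ (isPolynomial-q· poly)))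

isPolynomial-mul1-q^ : ∀ j k {f} → IsPolynomial (mul1-q^ k f) → IsPolynomial (mul1-q^ (j ℕ.+ k) f)
isPolynomial-mul1-q^ zero    k poly = poly
isPolynomial-mul1-q^ (suc j) k poly = isPolynomial-mul1-q (isPolynomial-mul1-q^ j k poly)

isRational-resp : ∀ {f g} → f ≋ g → IsRational g → IsRational f
isRational-resp f≋g (k , poly) = k , isPolynomial-resp (mul1-q^-cong k f≋g) poly

isRational-⊕ : ∀ {f g} → IsRational f → IsRational g → IsRational (f ⊕ g)
isRational-⊕ {f} {g} (k , polyf) (l , polyg) =
  k ℕ.+ l ,
  isPolynomial-resp (mul1-q^-⊕ (k ℕ.+ l) f g)
    (isPolynomial-⊕ (subst (λ e → IsPolynomial (mul1-q^ e f)) (ℕP.+-comm l k) (isPolynomial-mul1-q^ l k polyf))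
                    (isPolynomial-mul1-q^ k l polyg))

isRational-⊙ : ∀ c {f} → IsRational f → IsRational (c ⊙ f)
isRational-⊙ c {f} (k , poly) = k , isPolynomial-resp (mul1-q^-⊙ k c f) (isPolynomial-⊙ c poly)

isRational-q· : ∀ {f} → IsRational f → IsRational (q· f)
isRational-q· {f} (k , poly) = k , isPolynomial-resp (mul1-q^-q· k f) (isPolynomial-q· poly)

isRational-fixpoint : ∀ {f g} → f ≋ g ⊕ q· f → IsRational g → IsRational f
isRational-fixpoint {f} {g} f≋g+qf (k , poly) = suc k , isPolynomial-resp (fixpoint⇒mul1-q fₖ≋gₖ+qfₖ) poly
  where
  fₖ≋gₖ+qfₖ : mul1-q^ k f ≋ mul1-q^ k g ⊕ q· mul1-q^ k f
  fₖ≋gₖ+qfₖ = ≋-trans (mul1-q^-cong k f≋g+qf)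
                (≋-trans (mul1-q^-⊕ k g (q· f)) (⊕-cong ≋-refl (mul1-q^-q· k f)))

RCoeff-functional : ∀ {x y n c c′} → RCoeff x y n c → RCoeff x y n c′ → c ≡ c′
RCoeff-functional empty₀              empty₀              = refl
RCoeff-functional emptyₛ              emptyₛ              = refl
RCoeff-functional (00-zero {x = x} r) (00-zero r′)        = cong (tPow (- + ∣ x ∣ₓ) *L_) (RCoeff-functional r r′)
RCoeff-functional (00-suc {x = x} r s) (00-suc r′ s′)     =
  cong₂ (λ c d → tPow (- + ∣ x ∣ₓ) *L c +L tPow (- + ∣ x ∣ₓ) *L d) (RCoeff-functional r r′) (RCoeff-functional s s′)
RCoeff-functional (✕0 r)              (✕0 r′)             = RCoeff-functional r r′
RCoeff-functional (0✕ r)              (0✕ r′)             = RCoeff-functional r r′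
RCoeff-functional (✕✕ {x = x} r)      (✕✕ r′)             = cong ((tPow (+ ∣ x ∣ₓ) +L aL) *L_) (RCoeff-functional r r′)

RCoeff-∅ : ∀ {n c} → RCoeff [] [] n c → c ≡ polySeries (1L ∷ []) n
RCoeff-∅ empty₀ = refl
RCoeff-∅ emptyₛ = refl

RCoeff-✕✕⁻¹ : ∀ {x y n c} → RCoeff (✕ ∷ x) (✕ ∷ y) n c → ∃ (RCoeff x y n)
RCoeff-✕✕⁻¹ (✕✕ r) = _ , r

RCoeff-00⁻¹-✕ : ∀ {x y n c} → RCoeff (𝟘 ∷ x) (𝟘 ∷ y) n c → ∃ (RCoeff (x ∷ʳ ✕) (y ∷ʳ ✕) n)
RCoeff-00⁻¹-✕ (00-zero r)  = _ , r
RCoeff-00⁻¹-✕ (00-suc r s) = _ , r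

RCoeff-00⁻¹-𝟘 : ∀ {x y n c} → RCoeff (𝟘 ∷ x) (𝟘 ∷ y) (suc n) c → ∃ (RCoeff (x ∷ʳ 𝟘) (y ∷ʳ 𝟘) n)
RCoeff-00⁻¹-𝟘 (00-suc r s) = _ , s

IsR-∅ : ∀ {R} → IsR [] [] R → R ≋ polySeries (1L ∷ [])
IsR-∅ isR n = ≈-reflexive (RCoeff-∅ (isR n))

IsR-✕0 : ∀ {x y R} → IsR (✕ ∷ x) (𝟘 ∷ y) R → IsR (x ∷ʳ ✕) y R
IsR-✕0 isR n with isR n
... | ✕0 r = r

IsR-0✕ : ∀ {x y R} → IsR (𝟘 ∷ x) (✕ ∷ y) R → IsR x (y ∷ʳ ✕) R
IsR-0✕ isR n with isR n
... | 0✕ r = r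

IsR-✕✕ : ∀ {x y R} → IsR (✕ ∷ x) (✕ ∷ y) R →
  ∃[ R′ ] IsR x y R′ × R ≋ (tPow (+ ∣ x ∣ₓ) +L aL) ⊙ R′
IsR-✕✕ isR = R′ , isR′ , λ n → ≈-reflexive (RCoeff-functional (isR n) (✕✕ (isR′ n)))
  where
  R′ : Series
  R′ n = proj₁ (RCoeff-✕✕⁻¹ (isR n))
  isR′ : IsR _ _ R′
  isR′ n = proj₂ (RCoeff-✕✕⁻¹ (isR n))

record Expansion00 (x y : Word) (R : Series) : Set where
  field
    C D   : Series
    isR-C : IsR (x ∷ʳ ✕) (y ∷ʳ ✕) C
    isR-D : IsR (x ∷ʳ 𝟘) (y ∷ʳ 𝟘) D
    R≋    : R ≋ tPow (- + ∣ x ∣ₓ) ⊙ C ⊕ q· (tPow (- + ∣ x ∣ₓ) ⊙ D)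

IsR-00 : ∀ {x y R} → IsR (𝟘 ∷ x) (𝟘 ∷ y) R → Expansion00 x y R
IsR-00 {x} {y} {R} isR = record { C = C ; D = D ; isR-C = isR-C ; isR-D = isR-D ; R≋ = R≋ }
  where
  C D : Series
  C n = proj₁ (RCoeff-00⁻¹-✕ (isR n))
  D n = proj₁ (RCoeff-00⁻¹-𝟘 (isR (suc n)))
  isR-C : IsR (x ∷ʳ ✕) (y ∷ʳ ✕) C
  isR-C n = proj₂ (RCoeff-00⁻¹-✕ (isR n))
  isR-D : IsR (x ∷ʳ 𝟘) (y ∷ʳ 𝟘) D
  isR-D n = proj₂ (RCoeff-00⁻¹-𝟘 (isR (suc n)))
  R≋ : R ≋ tPow (- + ∣ x ∣ₓ) ⊙ C ⊕ q· (tPow (- + ∣ x ∣ₓ) ⊙ D)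
  R≋ zero    = ≈-reflexive (trans (RCoeff-functional (isR zero) (00-zero (isR-C zero))) (sym (++-identityʳ _)))
  R≋ (suc n) = ≈-reflexive (RCoeff-functional (isR (suc n)) (00-suc (isR-C (suc n)) (isR-D n)))

data Escapes : Word → Word → Set where
  []ˡ    : ∀ {y} → Escapes [] y
  []ʳ    : ∀ {x} → Escapes x []
  ✕ˡ     : ∀ {x y} → Escapes (✕ ∷ x) y
  ✕ʳ     : ∀ {x y} → Escapes x (✕ ∷ y)
  rotate : ∀ {x y} → Escapes (x ∷ʳ 𝟘) (y ∷ʳ 𝟘) → Escapes (𝟘 ∷ x) (𝟘 ∷ y)

Escapes-sym : ∀ {x y} → Escapes x y → Escapes y x
Escapes-sym []ˡ        = []ʳ
Escapes-sym []ʳ        = []ˡ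
Escapes-sym ✕ˡ         = ✕ʳ
Escapes-sym ✕ʳ         = ✕ˡ
Escapes-sym (rotate e) = rotate (Escapes-sym e)

escapes-✕ : ∀ n suf y → Escapes (replicate n 𝟘 ++ ✕ ∷ suf) y
escapes-✕ zero    suf y       = ✕ˡ
escapes-✕ (suc n) suf []      = []ʳ
escapes-✕ (suc n) suf (✕ ∷ y) = ✕ʳ
escapes-✕ (suc n) suf (𝟘 ∷ y) =
  rotate (subst (λ x → Escapes x (y ∷ʳ 𝟘)) (sym (++-assoc (replicate n 𝟘) (✕ ∷ suf) (𝟘 ∷ [])))
                (escapes-✕ n (suf ∷ʳ 𝟘) (y ∷ʳ 𝟘)))

data ZerosOr✕ : Word → Set where
  zeros : ∀ n → ZerosOr✕ (replicate n 𝟘)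
  has✕  : ∀ n suf → ZerosOr✕ (replicate n 𝟘 ++ ✕ ∷ suf)

zerosOr✕ : ∀ x → ZerosOr✕ x
zerosOr✕ []      = zeros 0
zerosOr✕ (✕ ∷ x) = has✕ 0 x
zerosOr✕ (𝟘 ∷ x) with zerosOr✕ x
... | zeros n     = zeros (suc n)
... | has✕ n suf  = has✕ (suc n) suf

data Shape : Word → Word → Set where
  escaping : ∀ {x y} → Escapes x y → Shape x y
  allZeros : ∀ m n → Shape (replicate (suc m) 𝟘) (replicate (suc n) 𝟘)

shape : ∀ x y → Shape x y
shape x y with zerosOr✕ x | zerosOr✕ y
... | has✕ m suf    | _             = escaping (escapes-✕ m suf y)
... | zeros m       | has✕ n suf    = escaping (Escapes-sym (escapes-✕ n suf _))
... | zeros zero    | zeros _       = escaping []ˡ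
... | zeros (suc m) | zeros zero    = escaping []ʳ
... | zeros (suc m) | zeros (suc n) = allZeros m n

letterWeight : Letter → ℕ
letterWeight 𝟘 = 2
letterWeight ✕ = 1

weight : Word → ℕ
weight []      = 0
weight (l ∷ x) = letterWeight l ℕ.+ weight x

weight-∷ʳ : ∀ x l → weight (x ∷ʳ l) ≡ weight (l ∷ x)
weight-∷ʳ []       l = refl
weight-∷ʳ (l′ ∷ x) l = trans (cong (letterWeight l′ ℕ.+_) (weight-∷ʳ x l))
                             (x∙yz≈y∙xz ℕP.+-commutativeSemigroup (letterWeight l′) (letterWeight l) (weight x))

μ : Word → Word → ℕ
μ x y = weight x ℕ.+ weight y

μ-rotate : ∀ x y → μ (x ∷ʳ 𝟘) (y ∷ʳ 𝟘) ≡ μ (𝟘 ∷ x) (𝟘 ∷ y)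
μ-rotate x y = cong₂ ℕ._+_ (weight-∷ʳ x 𝟘) (weight-∷ʳ y 𝟘)

μ-✕0 : ∀ x y → μ (x ∷ʳ ✕) y < μ (✕ ∷ x) (𝟘 ∷ y)
μ-✕0 x y rewrite weight-∷ʳ x ✕ = ℕP.+-monoʳ-< (weight (✕ ∷ x)) (ℕP.m<n+m (weight y) {2} ℕ.z<s)

μ-0✕ : ∀ x y → μ x (y ∷ʳ ✕) < μ (𝟘 ∷ x) (✕ ∷ y)
μ-0✕ x y rewrite weight-∷ʳ y ✕ = ℕP.+-monoˡ-< (weight (✕ ∷ y)) (ℕP.m<n+m (weight x) {2} ℕ.z<s)

μ-✕✕ : ∀ x y → μ x y < μ (✕ ∷ x) (✕ ∷ y)
μ-✕✕ x y = ℕP.+-mono-< (ℕP.n<1+n (weight x)) (ℕP.n<1+n (weight y))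

μ-00 : ∀ x y → μ (x ∷ʳ ✕) (y ∷ʳ ✕) < μ (𝟘 ∷ x) (𝟘 ∷ y)
μ-00 x y rewrite weight-∷ʳ x ✕ | weight-∷ʳ y ✕ =
  ℕP.+-mono-< (ℕP.n<1+n (weight (✕ ∷ x))) (ℕP.n<1+n (weight (✕ ∷ y)))

replicate-∷ʳ : ∀ {ℓ} {A : Set ℓ} n (a : A) → replicate n a ∷ʳ a ≡ a ∷ replicate n a
replicate-∷ʳ zero    a = refl
replicate-∷ʳ (suc n) a = cong (a ∷_) (replicate-∷ʳ n a)

∣replicate-𝟘∣ₓ : ∀ n → ∣ replicate n 𝟘 ∣ₓ ≡ 0
∣replicate-𝟘∣ₓ zero    = refl
∣replicate-𝟘∣ₓ (suc n) = ∣replicate-𝟘∣ₓ n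

RIsRational : Word → Word → Set
RIsRational x y = ∀ R → IsR x y R → IsRational R

rational-∅ : RIsRational [] []
rational-∅ R isR = 0 , 1L ∷ [] , IsR-∅ isR

module _ {m} (ih : ∀ {x y} → μ x y < m → RIsRational x y) where

  private
    below : ∀ {x y w} → μ x y < w → w ≡ m → RIsRational x y
    below lt refl = ih lt

  rational-escaping : ∀ x y → μ x y ≡ m → Escapes x y → RIsRational x y
  rational-escaping []      []      _ _ = rational-∅
  rational-escaping []      (_ ∷ _) _ _ R isR with isR 0
  ... | ()
  rational-escaping (_ ∷ _) []      _ _ R isR with isR 0
  ... | ()
  rational-escaping (✕ ∷ x) (𝟘 ∷ y) eq _ R isR = below (μ-✕0 x y) eq R (IsR-✕0 isR)
  rational-escaping (𝟘 ∷ x) (✕ ∷ y) eq _ R isR = below (μ-0✕ x y) eq R (IsR-0✕ isR)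
  rational-escaping (✕ ∷ x) (✕ ∷ y) eq _ R isR with IsR-✕✕ isR
  ... | R′ , isR′ , R≋ =
    isRational-resp R≋ (isRational-⊙ (tPow (+ ∣ x ∣ₓ) +L aL) (below (μ-✕✕ x y) eq R′ isR′))
  rational-escaping (𝟘 ∷ x) (𝟘 ∷ y) eq (rotate e) R isR =
    isRational-resp R≋
      (isRational-⊕ (isRational-⊙ (tPow (- + ∣ x ∣ₓ)) (below (μ-00 x y) eq C isR-C))
                    (isRational-q· (isRational-⊙ (tPow (- + ∣ x ∣ₓ)) rational-D)))
    where
    open Expansion00 (IsR-00 isR)
    rational-D : IsRational D
    rational-D = rational-escaping (x ∷ʳ 𝟘) (y ∷ʳ 𝟘) (trans (μ-rotate x y) eq) e D isR-D

  rational-allZeros : ∀ k l → μ (replicate (suc k) 𝟘) (replicate (suc l) 𝟘) ≡ m →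
    RIsRational (replicate (suc k) 𝟘) (replicate (suc l) 𝟘)
  rational-allZeros k l eq R isR = isRational-fixpoint R≋tC+qR (isRational-⊙ t rational-C)
    where
    open Expansion00 (IsR-00 isR)
    t : L
    t = tPow (- + ∣ replicate k 𝟘 ∣ₓ)
    rational-C : IsRational C
    rational-C = below (μ-00 (replicate k 𝟘) (replicate l 𝟘)) eq C isR-C
    t*L≡ : ∀ p → t *L p ≡ p
    t*L≡ p rewrite ∣replicate-𝟘∣ₓ k = *L-identityˡ p
    D≡R : ∀ n → D n ≡ R n
    D≡R n = RCoeff-functional
      (subst₂ (λ u v → RCoeff u v n (D n)) (replicate-∷ʳ k 𝟘) (replicate-∷ʳ l 𝟘) (isR-D n)) (isR n)
    R≋tC+qR : R ≋ t ⊙ C ⊕ q· R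
    R≋tC+qR = ≋-trans R≋ (⊕-cong ≋-refl (q·-cong λ n → ≈-reflexive (trans (t*L≡ (D n)) (D≡R n))))

rational : ∀ x y → RIsRational x y
rational x y = <-rec (λ m → ∀ x y → μ x y ≡ m → RIsRational x y) step (μ x y) x y refl
  where
  step : ∀ m → (∀ {m′} → m′ < m → ∀ x y → μ x y ≡ m′ → RIsRational x y) →
         ∀ x y → μ x y ≡ m → RIsRational x y
  step m rec x y eq with shape x y
  ... | escaping e   = rational-escaping (λ lt → rec lt _ _ refl) x y eq e
  ... | allZeros k l = rational-allZeros (λ lt → rec lt _ _ refl) k l eq

mainTheorem10 : (x y : Word) (R : Series) → IsR x y R →
    ∃[ k ] ∃[ P ] (∀ n → mul1-q^ k R n ≈L polySeries P n)
mainTheorem10 x y R isR with rational x y R isR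
... | k , P , R≋P = k , P , λ n → coeff-≡ (R≋P n)
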